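{- Let $k>n\ge 1$ be integers and let $y=(y_1,\dots,y_n)\in\{1,\dots,k\}^n$ have pairwise distinct entries. For $j\in\{1,\dots,k\}$ define $\sigma^j=(\sigma^j_1,\dots,\sigma^j_n)$ by $\sigma^j_i=((i+j-2)\bmod k)+1$ for $i\in\{1,\dots,n\}$ (so $\sigma^1=(1,2,\dots,n)$, $\sigma^2=(2,3,\dots,n+1)$, \dots, $\sigma^k=(k,1,\dots,n-1)$), and let $\mathrm{black}(\sigma^j,y)=|\{i\in\{1,\dots,n\}:\sigma^j_i=y_i\}|$. Then there exists $j\in\{1,\dots,k\}$ such that $\mathrm{black}(\sigma^j,y)=0$. -}

module Defs where

open import Data.Nat using (ℕ; suc; _+_; _∸_; NonZero)
open import Data.Nat.DivMod using (_%_)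
open import Data.Fin using (Fin; toℕ)
open import Data.List using (List; length; filter)
open import Data.List using () renaming (allFin to allFinL)
open import Data.Nat using (_≟_)

-- σ^j_i = ((i + j - 2) mod k) + 1, for 1-based i, j (i + j ≥ 2 so ∸ is exact)
σ : (k : ℕ) → .{{NonZero k}} → (j i : ℕ) → ℕ
σ k j i = ((i + j ∸ 2) % k) + 1

-- black(σ^j, y) = |{ i ∈ {1..n} : σ^j_i = y_i }|
-- y is given as Fin n → ℕ; position p : Fin n corresponds to index i = toℕ p + 1.
black : (k : ℕ) → .{{NonZero k}} → (n j : ℕ) → (Fin n → ℕ) → ℕ
black k n j y = length (filter (λ p → σ k j (suc (toℕ p)) ≟ y p) (allFinL n))

module Submission where

-- The shift σ^{j+1} at position p+1 equals ((p + j) mod k) + 1.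
-- For a fixed position p the map j ↦ (p + j) mod k is injective on j < k, so
-- each position p agrees with y for at most ONE shift j.  Choosing, for every
-- shift, a position where it agrees with y would therefore give an injection
-- from the k shifts into the n < k positions, contradicting the pigeonhole
-- principle; so some shift agrees with y nowhere, and for that shift the
-- filtered list defining black is empty.

open import Defs
open import Data.Nat using (ℕ; _≤_; _<_; NonZero; suc; _+_; _*_; _∸_; _≟_; z≤n; s≤s)
open import Data.Nat.Properties using (≤-total; m+[n∸m]≡n; m∸n≤m; ≤-<-trans; +-assoc; +-suc; +-identityʳ; +-cancelˡ-≡; +-cancelʳ-≡; <⇒≱)
open import Data.Nat.DivMod using (_%_; _/_; m≡m%n+[m/n]*n)
open import Data.Nat.Divisibility using (_∣_; ∣⇒≤; ∣m+n∣m⇒∣n; n∣m*n)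
open import Data.Fin using (Fin; toℕ)
open import Data.Fin.Properties using (pigeonhole; any?; ¬∀⟶∃¬; toℕ<n; toℕ-injective; <⇒≢)
open import Data.Sum using (inj₁; inj₂)
open import Data.Product using (Σ; _×_; _,_; proj₁; proj₂; ∃)
open import Data.List using (length) renaming (allFin to allFinL)
open import Data.List.Properties using (filter-none)
open import Data.List.Relation.Unary.All using (universal)
open import Relation.Binary.PropositionalEquality using (_≡_; refl; sym; trans; cong; subst; module ≡-Reasoning)
open import Relation.Nullary using (¬_; Dec; contradiction)
open import Function.Definitions using (Injective)

-- Adding d leaves the residue of a modulo k unchanged only if k divides d:
-- from a = r + q k and a + d = r + q' k we get q k + d = q' k.
%-shift⇒∣ : ∀ k .{{_ : NonZero k}} a d → (a + d) % k ≡ a % k → k ∣ d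
%-shift⇒∣ k a d eq =
  ∣m+n∣m⇒∣n (subst (k ∣_) (sym qk+d≡q'k) (n∣m*n q')) (n∣m*n q)
  where
  open ≡-Reasoning
  r q q' : ℕ
  r = a % k
  q = a / k
  q' = (a + d) / k
  qk+d≡q'k : q * k + d ≡ q' * k
  qk+d≡q'k = +-cancelˡ-≡ r _ _ (begin
    r + (q * k + d)       ≡⟨ sym (+-assoc r _ d) ⟩
    r + q * k + d         ≡⟨ cong (_+ d) (sym (m≡m%n+[m/n]*n a k)) ⟩
    a + d                 ≡⟨ m≡m%n+[m/n]*n (a + d) k ⟩
    (a + d) % k + q' * k  ≡⟨ cong (_+ q' * k) eq ⟩
    r + q' * k            ∎)

∣∧<⇒≡0 : ∀ {k d} → k ∣ d → d < k → d ≡ 0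
∣∧<⇒≡0 {d = 0}     _   _   = refl
∣∧<⇒≡0 {d = suc _} k∣d d<k = contradiction (∣⇒≤ k∣d) (<⇒≱ d<k)

-- Translation by a is injective on residues below k, ordered case: if
-- u ≤ v < k and a + v ≡ a + u mod k, then k divides v ∸ u < k, so u = v.
+-%-injective-≤ : ∀ k .{{_ : NonZero k}} a {u v} → u ≤ v → v < k →
                  (a + v) % k ≡ (a + u) % k → u ≡ v
+-%-injective-≤ k a {u} {v} u≤v v<k eq = begin
  u            ≡⟨ sym (+-identityʳ u) ⟩
  u + 0        ≡⟨ cong (u +_) (sym v∸u≡0) ⟩
  u + (v ∸ u)  ≡⟨ m+[n∸m]≡n u≤v ⟩
  v            ∎
  where
  open ≡-Reasoning
  a+v≡a+u+[v∸u] : a + v ≡ a + u + (v ∸ u)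
  a+v≡a+u+[v∸u] = trans (cong (a +_) (sym (m+[n∸m]≡n u≤v))) (sym (+-assoc a u _))
  v∸u≡0 : v ∸ u ≡ 0
  v∸u≡0 = ∣∧<⇒≡0
    (%-shift⇒∣ k (a + u) (v ∸ u) (trans (cong (_% k) (sym a+v≡a+u+[v∸u])) eq))
    (≤-<-trans (m∸n≤m v u) v<k)

+-%-injective : ∀ k .{{_ : NonZero k}} a {t t'} → t < k → t' < k →
                (a + t) % k ≡ (a + t') % k → t ≡ t'
+-%-injective k a {t} {t'} t<k t'<k eq with ≤-total t t'
... | inj₁ t≤t' = +-%-injective-≤ k a t≤t' t'<k (sym eq)
... | inj₂ t'≤t = sym (+-%-injective-≤ k a t'≤t t<k eq)

-- Pigeonhole for shifts: if every position p is related to at most one of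
-- the k shifts and there are only n < k positions, not every shift can be
-- related to a position (a choice of one position per shift would be injective).
not-all-related : ∀ {k n} → n < k → (R : Fin k → Fin n → Set) →
  (∀ {j j' p} → R j p → R j' p → j ≡ j') → ¬ (∀ j → ∃ (R j))
not-all-related n<k R unique related
  with pigeonhole n<k (λ j → proj₁ (related j))
... | i , j , i<j , same-choice =
  <⇒≢ i<j (unique (proj₂ (related i)) Rj[choice-i])
  where
  Rj[choice-i] : R j (proj₁ (related i))
  Rj[choice-i] = subst (R j) (sym same-choice) (proj₂ (related j))

some-shift-unrelated : ∀ {k n} → n < k → (R : Fin k → Fin n → Set) →
  (∀ j p → Dec (R j p)) → (∀ {j j' p} → R j p → R j' p → j ≡ j') →
  ∃ λ j → ∀ p → ¬ R j p
some-shift-unrelated {k} n<k R R? unique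
  with ¬∀⟶∃¬ k _ (λ j → any? (R? j)) (not-all-related n<k R unique)
... | j , ¬∃Rj = j , λ p Rjp → ¬∃Rj (p , Rjp)

σ-as-translation : ∀ k .{{_ : NonZero k}} j p → σ k (suc j) (suc p) ≡ (p + j) % k + 1
σ-as-translation k j p rewrite +-suc p j = refl

module _ (k : ℕ) .{{_ : NonZero k}} {n : ℕ} (y : Fin n → ℕ) where

  Agrees : Fin k → Fin n → Set
  Agrees j p = σ k (suc (toℕ j)) (suc (toℕ p)) ≡ y p

  agrees? : ∀ j p → Dec (Agrees j p)
  agrees? j p = σ k (suc (toℕ j)) (suc (toℕ p)) ≟ y p

  agrees-unique : ∀ {j j' p} → Agrees j p → Agrees j' p → j ≡ j'
  agrees-unique {j} {j'} {p} agrees agrees' =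
    toℕ-injective (+-%-injective k (toℕ p) (toℕ<n j) (toℕ<n j') same-residue)
    where
    same-residue : (toℕ p + toℕ j) % k ≡ (toℕ p + toℕ j') % k
    same-residue = +-cancelʳ-≡ 1 _ _ (begin
      (toℕ p + toℕ j) % k + 1          ≡⟨ sym (σ-as-translation k (toℕ j) (toℕ p)) ⟩
      σ k (suc (toℕ j)) (suc (toℕ p))   ≡⟨ trans agrees (sym agrees') ⟩
      σ k (suc (toℕ j')) (suc (toℕ p))  ≡⟨ σ-as-translation k (toℕ j') (toℕ p) ⟩
      (toℕ p + toℕ j') % k + 1         ∎)
      where open ≡-Reasoning

  black-of-disagreeing : ∀ j → (∀ p → ¬ Agrees j p) → black k n (suc (toℕ j)) y ≡ 0
  black-of-disagreeing j disagrees =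
    cong length (filter-none (agrees? j) (universal disagrees (allFinL n)))

lemma1 : (k n : ℕ) → .{{_ : NonZero k}} → 1 ≤ n → n < k →
    (y : Fin n → ℕ) → (∀ p → 1 ≤ y p × y p ≤ k) → Injective _≡_ _≡_ y →
    Σ ℕ (λ j → (1 ≤ j × j ≤ k) × black k n j y ≡ 0)
lemma1 k n _ n<k y _ _
  with some-shift-unrelated n<k (Agrees k y) (agrees? k y) (agrees-unique k y)
... | j , disagrees =
  suc (toℕ j) , (s≤s z≤n , toℕ<n j) , black-of-disagreeing k y j disagrees
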